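{- For $n\ge1$ and $k\ge1$, the set $M_{n,k}$ of sets of $k$ minimal rooted trees whose vertex sets form a set partition of $[n]$ is in bijection with the set $T'_{n,k}$ of rooted labeled non-planar trees on $[n]$ whose maximal decreasing subtree is a chain with $k$ vertices.
   Context: A rooted labeled non-planar tree on a finite set $S$ of positive integers is a rooted tree whose vertices are labeled bijectively by $S$ (children unordered). Its maximal decreasing subtree is the maximal subtree containing the root all of whose edges go from a parent to a child with smaller label. A minimal rooted tree is a rooted labeled non-planar tree whose maximal decreasing subtree consists of the root alone. The maximal decreasing subtree is a chain if it is a path starting at the root. -}

module Defs where

open import Data.Nat using (ℕ; zero; suc; _<ᵇ_; _≡ᵇ_; _≤ᵇ_)
open import Data.Fin using (Fin; toℕ)
open import Data.Maybe using (Maybe; just; nothing; is-nothing)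
open import Data.Vec using (Vec; lookup)
open import Data.List using (List; length; filterᵇ; allFin; foldr; map)
open import Data.Bool using (Bool; true; false; _∧_; T)
open import Data.Product using (Σ)

-- Vertex i : Fin n carries the label (toℕ i + 1) ∈ [n]; comparisons of labels
-- are comparisons of toℕ, which is order preserving.
-- A rooted labeled non-planar forest on [n] is encoded by its parent array:
-- entry v is  nothing  if v is a root, and  just p  if p is the parent of v.
ParentArray : ℕ → Set
ParentArray n = Vec (Maybe (Fin n)) n

count : ∀ {n} → (Fin n → Bool) → ℕ
count {n} P = length (filterᵇ P (allFin n))

allV : ∀ {n} → (Fin n → Bool) → Bool
allV {n} P = foldr _∧_ true (map P (allFin n))

reachesRoot : ∀ {n} → ℕ → ParentArray n → Fin n → Bool
reachesRoot zero    π v = false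
reachesRoot (suc f) π v with lookup π v
... | nothing = true
... | just p  = reachesRoot f π p

-- acyclic parent array (every vertex reaches a root); n lookups suffice
isForest : ∀ {n} → ParentArray n → Bool
isForest {n} π = allV (reachesRoot n π)

isRoot : ∀ {n} → ParentArray n → Fin n → Bool
isRoot π v = is-nothing (lookup π v)

numRoots : ∀ {n} → ParentArray n → ℕ
numRoots π = count (isRoot π)

isTree : ∀ {n} → ParentArray n → Bool
isTree π = isForest π ∧ (numRoots π ≡ᵇ 1)

isChildOf : ∀ {n} → ParentArray n → Fin n → Fin n → Bool
isChildOf π u v with lookup π u
... | nothing = false
... | just p  = toℕ p ≡ᵇ toℕ v

-- every tree of the forest is minimal: its maximal decreasing subtree is the root
-- alone, i.e. every child of a root has a larger label than that root
allTreesMinimal : ∀ {n} → ParentArray n → Bool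
allTreesMinimal π = allV λ v → helper v (lookup π v)
  where
  helper : _ → Maybe _ → Bool
  helper v nothing  = true
  helper v (just p) with isRoot π p
  ... | true  = toℕ p <ᵇ toℕ v
  ... | false = true

inMaxDec : ∀ {n} → ℕ → ParentArray n → Fin n → Bool
inMaxDec zero    π v = false
inMaxDec (suc f) π v with lookup π v
... | nothing = true
... | just p  = (toℕ v <ᵇ toℕ p) ∧ inMaxDec f π p

inMaxDecSubtree : ∀ {n} → ParentArray n → Fin n → Bool
inMaxDecSubtree {n} π = inMaxDec n π

-- the maximal decreasing subtree is a chain (path starting at the root):
-- every vertex has at most one child inside the subtree
maxDecIsChain : ∀ {n} → ParentArray n → Bool
maxDecIsChain π =
  allV λ v → count (λ u → isChildOf π u v ∧ inMaxDecSubtree π u) ≤ᵇ 1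

maxDecSize : ∀ {n} → ParentArray n → ℕ
maxDecSize π = count (inMaxDecSubtree π)

-- M_{n,k}: sets of k minimal rooted trees whose vertex sets partition [n]
-- (= rooted forests on [n] with k trees, each minimal)
M : ℕ → ℕ → Set
M n k = Σ (ParentArray n) λ π →
  T (isForest π ∧ (numRoots π ≡ᵇ k) ∧ allTreesMinimal π)

T′ : ℕ → ℕ → Set
T′ n k = Σ (ParentArray n) λ π →
  T (isTree π ∧ maxDecIsChain π ∧ (maxDecSize π ≡ᵇ k))

-- Hang each root of a forest of k minimal trees below the next larger root. Every child of an
-- original root has a larger label than that root (minimality), so a decreasing path from the new
-- root can never leave the chain of old roots: the maximal decreasing subtree of the resulting tree
-- is exactly that chain, with k vertices. Conversely, deleting the edges of a decreasing chain leaves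
-- k minimal trees rooted at the chain vertices, and relinking recovers the chain because along it
-- labels decrease strictly with depth.
module Submission where

open import Defs
open import Data.Bool using (Bool; true; false; _∧_; T; if_then_else_)
open import Data.Bool.Properties using (T-∧; T-≡; T-irrelevant; ¬-not)
open import Data.Fin using (Fin; zero; suc; toℕ; _>_; fromℕ<)
open import Data.Fin.Properties using (toℕ-injective; toℕ≤pred[n]; injective⇒≤)
  renaming (suc-injective to Fin-suc-injective; _≟_ to _≟ᶠ_)
open import Data.Fin.Induction using (>-wellFounded)
open import Data.List using (length; filterᵇ; allFin; tabulate)
open import Data.List.Properties using (filter-≐; filter-some; filter-none)
open import Data.List.Membership.Propositional using (lose)
open import Data.List.Membership.Propositional.Properties using (∈-allFin)
import Data.List.Relation.Unary.All.Properties as All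
open import Data.Maybe using (Maybe; just; nothing; _<∣>_)
import Data.Maybe as Maybe
open import Data.Maybe.Properties using (just-injective)
open import Data.Nat using (ℕ; zero; suc; _≤_; _<_; _∸_; z≤n; s≤s; _≡ᵇ_; _<ᵇ_; s≤s⁻¹)
open import Data.Nat.Properties
  using (≡ᵇ⇒≡; ≡⇒≡ᵇ; <ᵇ⇒<; <⇒<ᵇ; ≤ᵇ⇒≤; ≤⇒≤ᵇ; ≤-antisym; ≤-reflexive; ≤-trans;
         <-irrefl; <-asym; <-trans; <-cmp; <⇒≱; ∸-cancelˡ-≡; 0≢1+n; m<1+n⇒m<n∨m≡n)
open import Data.Product using (∃; _×_; _,_; proj₁; proj₂)
open import Data.Sum using (inj₁; inj₂)
open import Data.Unit using (tt)
open import Data.Vec using (Vec; lookup)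
import Data.Vec as Vec
open import Data.Vec.Properties using (lookup∘tabulate; tabulate∘lookup; tabulate-cong)
open import Function using (_∘_; _⇔_; mk⇔; Equivalence)
open import Function.Bundles using (_↔_; mk↔ₛ′)
open import Induction.WellFounded using (Acc; acc)
open import Relation.Binary.Definitions using (tri<; tri≈; tri>)
open import Relation.Binary.PropositionalEquality using (_≡_; _≢_; refl; sym; trans; cong; subst)
open import Relation.Nullary using (¬_; yes; no; contradiction)
open import Relation.Nullary.Decidable using (T?)

∧-split : ∀ {a b} → T (a ∧ b) → T a × T b
∧-split = Equivalence.to T-∧

∧-split₃ : ∀ {a b c} → T (a ∧ b ∧ c) → T a × T b × T c
∧-split₃ t = let (ta , tbc) = ∧-split t in ta , ∧-split tbc

∧-join : ∀ {a b} → T a → T b → T (a ∧ b)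
∧-join ta tb = Equivalence.from T-∧ (ta , tb)

T-subtype-≡ : ∀ {A : Set} {P : A → Bool} {a b : A} {p : T (P a)} {q : T (P b)} →
  a ≡ b → _≡_ {A = ∃ λ x → T (P x)} (a , p) (b , q)
T-subtype-≡ {a = a} refl = cong (a ,_) (T-irrelevant _ _)

lookup-ext : ∀ {A : Set} {n} {xs ys : Vec A n} → (∀ i → lookup xs i ≡ lookup ys i) → xs ≡ ys
lookup-ext {xs = xs} {ys} h =
  trans (sym (tabulate∘lookup xs)) (trans (tabulate-cong h) (tabulate∘lookup ys))

AtMostOne : ∀ {n} → (Fin n → Bool) → Set
AtMostOne P = ∀ {a b} → T (P a) → T (P b) → a ≡ b

allV⁻ : ∀ {n} {P : Fin n → Bool} → T (allV P) → ∀ v → T (P v)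
allV⁻ {n} {P} t = All.tabulate⁻ (All.all⁺ P (allFin n) t)

allV⁺ : ∀ {n} {P : Fin n → Bool} → (∀ v → T (P v)) → T (allV P)
allV⁺ {P = P} h = All.all⁻ P (All.tabulate⁺ h)

count-cong : ∀ {n} {P Q : Fin n → Bool} → (∀ v → P v ≡ Q v) → count P ≡ count Q
count-cong {n} {P} {Q} P≗Q = cong length
  (filter-≐ (T? ∘ P) (T? ∘ Q) ((λ {v} → subst T (P≗Q v)) , (λ {v} → subst T (sym (P≗Q v)))) (allFin n))

count-pos : ∀ {n} {P : Fin n → Bool} {a} → T (P a) → 1 ≤ count P
count-pos {P = P} {a} pa = filter-some (T? ∘ P) (lose (∈-allFin a) pa)

count-none : ∀ {n} {P : Fin n → Bool} → (∀ v → ¬ T (P v)) → count P ≡ 0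
count-none {P = P} none = cong length (filter-none (T? ∘ P) (All.tabulate⁺ none))

count-tabulate : ∀ {m n} (f : Fin n → Fin m) (P : Fin m → Bool) →
  length (filterᵇ P (tabulate f)) ≡ count (P ∘ f)
count-tabulate {n = zero}  f P = refl
count-tabulate {n = suc n} f P with P (f zero)
... | true  = cong suc (trans (count-tabulate (f ∘ suc) P) (sym (count-tabulate suc (P ∘ f))))
... | false = trans (count-tabulate (f ∘ suc) P) (sym (count-tabulate suc (P ∘ f)))

count-suc : ∀ {n} (P : Fin (suc n) → Bool) →
  count P ≡ (if P zero then suc (count (P ∘ suc)) else count (P ∘ suc))
count-suc P with P zero
... | true  = cong suc (count-tabulate suc P)
... | false = count-tabulate suc P

atMostOne⇒count≤1 : ∀ {n} {P : Fin n → Bool} → AtMostOne P → count P ≤ 1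
atMostOne⇒count≤1 {zero} _ = z≤n
atMostOne⇒count≤1 {suc n} {P} unique rewrite count-suc P with P zero in p₀
... | true  = s≤s (≤-reflexive (count-none {P = P ∘ suc} λ v pv →
                0≢1+n (cong toℕ (unique (Equivalence.from T-≡ p₀) pv))))
... | false = atMostOne⇒count≤1 (λ pa pb → Fin-suc-injective (unique pa pb))

distinct⇒2≤count : ∀ {n} {P : Fin n → Bool} {a b} → a ≢ b → T (P a) → T (P b) → 2 ≤ count P
distinct⇒2≤count {suc n} {P} {zero} {zero} a≢b _ _ = contradiction refl a≢b
distinct⇒2≤count {suc n} {P} {zero} {suc b} _ pa pb rewrite count-suc P with P zero
... | true  = s≤s (count-pos {P = P ∘ suc} pb)
... | false = contradiction pa λ ()
distinct⇒2≤count {suc n} {P} {suc a} {zero} _ pa pb rewrite count-suc P with P zero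
... | true  = s≤s (count-pos {P = P ∘ suc} pa)
... | false = contradiction pb λ ()
distinct⇒2≤count {suc n} {P} {suc a} {suc b} a≢b pa pb rewrite count-suc P with P zero
... | true  = s≤s (count-pos {P = P ∘ suc} pa)
... | false = distinct⇒2≤count (a≢b ∘ cong suc) pa pb

count≤1⇒atMostOne : ∀ {n} {P : Fin n → Bool} → count P ≤ 1 → AtMostOne P
count≤1⇒atMostOne count≤1 {a} {b} pa pb with a ≟ᶠ b
... | yes a≡b = a≡b
... | no a≢b  = contradiction (≤-trans (distinct⇒2≤count a≢b pa pb) count≤1) λ { (s≤s ()) }

count≡1 : ∀ {n} {P : Fin n → Bool} {a} → T (P a) → AtMostOne P → count P ≡ 1
count≡1 {P = P} pa unique = ≤-antisym (atMostOne⇒count≤1 {P = P} unique) (count-pos {P = P} pa)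

first : ∀ {n} → (Fin n → Bool) → Maybe (Fin n)
first {zero}  P = nothing
first {suc n} P = if P zero then just zero else Maybe.map suc (first (P ∘ suc))

first-nothing : ∀ {n} (P : Fin n → Bool) → first P ≡ nothing → ∀ t → ¬ T (P t)
first-nothing {suc n} P e t with P zero in p₀ | first (P ∘ suc) in e′
first-nothing {suc n} P () t       | true  | _
first-nothing {suc n} P e zero     | false | nothing = subst T p₀
first-nothing {suc n} P e (suc t)  | false | nothing = first-nothing (P ∘ suc) e′ t
first-nothing {suc n} P () t       | false | just _

first-just : ∀ {n} (P : Fin n → Bool) {s} → first P ≡ just s →
  T (P s) × (∀ t → toℕ t < toℕ s → ¬ T (P t))
first-just {suc n} P e with P zero in p₀ | first (P ∘ suc) in e′
first-just {suc n} P refl | true  | _      = Equivalence.from T-≡ p₀ , λ _ ()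
first-just {suc n} P ()   | false | nothing
first-just {suc n} P refl | false | just s with first-just (P ∘ suc) e′
... | ps , below = ps , λ { zero _ → subst T p₀ ; (suc t) (s≤s t<s) → below t t<s }

module _ {n : ℕ} (π : ParentArray n) where

  parent-unique : ∀ {v p q} → lookup π v ≡ just p → lookup π v ≡ just q → p ≡ q
  parent-unique e e′ = just-injective (trans (sym e) e′)

  root-has-no-parent : ∀ {v p} → lookup π v ≡ nothing → ¬ lookup π v ≡ just p
  root-has-no-parent e e′ with () ← trans (sym e) e′

  isRoot⁻ : ∀ {v} → T (isRoot π v) → lookup π v ≡ nothing
  isRoot⁻ {v} t with lookup π v | t
  ... | nothing | _ = refl

  isRoot⁺ : ∀ {v} → lookup π v ≡ nothing → T (isRoot π v)
  isRoot⁺ e rewrite e = tt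

  isChildOf⁻ : ∀ {u v} → T (isChildOf π u v) → lookup π u ≡ just v
  isChildOf⁻ {u} {v} t with lookup π u | t
  ... | just p | p≡v = cong just (toℕ-injective (≡ᵇ⇒≡ (toℕ p) (toℕ v) p≡v))

  isChildOf⁺ : ∀ {u v} → lookup π u ≡ just v → T (isChildOf π u v)
  isChildOf⁺ {v = v} e rewrite e = ≡⇒≡ᵇ (toℕ v) (toℕ v) refl

  Minimal : Set
  Minimal = ∀ {v p} → lookup π v ≡ just p → lookup π p ≡ nothing → toℕ p < toℕ v

  -- Defs phrases the vertex condition of allTreesMinimal through a local helper; this names it.
  minimalAt : ∃ λ (P : Fin n → Bool) → allTreesMinimal π ≡ allV P
  minimalAt = _ , refl

  allTreesMinimal⁻ : T (allTreesMinimal π) → Minimal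
  allTreesMinimal⁻ t {v} {p} ev ep with lookup π v | allV⁻ {P = proj₁ minimalAt} t v | ev
  ... | just _ | tv | refl with isRoot π p | tv | isRoot⁺ ep
  ...   | true | p<v | _ = <ᵇ⇒< _ _ p<v

  allTreesMinimal⁺ : Minimal → T (allTreesMinimal π)
  allTreesMinimal⁺ minimal = allV⁺ minimalAtVertex
    where
    minimalAtVertex : ∀ v → T (proj₁ minimalAt v)
    minimalAtVertex v with lookup π v in ev
    ... | nothing = tt
    ... | just p with isRoot π p in ep
    ...   | true  = <⇒<ᵇ (minimal ev (isRoot⁻ (Equivalence.from T-≡ ep)))
    ...   | false = tt

  data Depth : Fin n → ℕ → Set where
    root : ∀ {v} → lookup π v ≡ nothing → Depth v 0
    step : ∀ {v p d} → lookup π v ≡ just p → Depth p d → Depth v (suc d)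

  IsForest : Set
  IsForest = ∀ v → ∃ (Depth v)

  depth-unique : ∀ {v a b} → Depth v a → Depth v b → a ≡ b
  depth-unique (root _)    (root _)     = refl
  depth-unique (root e)    (step e′ _)  = contradiction e′ (root-has-no-parent e)
  depth-unique (step e _)  (root e′)    = contradiction e (root-has-no-parent e′)
  depth-unique (step e dp) (step e′ dq) with refl ← parent-unique e e′ = cong suc (depth-unique dp dq)

  depth⇒root : ∀ {v d} → Depth v d → ∃ λ r → lookup π r ≡ nothing
  depth⇒root (root e)    = _ , e
  depth⇒root (step _ dp) = depth⇒root dp

  ancestor : ∀ {v d} → Depth v d → Fin (suc d) → Fin n
  ancestor {v} _ zero             = v
  ancestor (step _ dp) (suc i)    = ancestor dp i

  ancestor-depth : ∀ {v d} (dv : Depth v d) (i : Fin (suc d)) → Depth (ancestor dv i) (d ∸ toℕ i)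
  ancestor-depth dv          zero    = dv
  ancestor-depth (step _ dp) (suc i) = ancestor-depth dp i

  -- The d + 1 ancestors of a vertex of depth d have distinct depths, hence are distinct.
  depth<n : ∀ {v d} → Depth v d → d < n
  depth<n {d = d} dv = injective⇒≤ ancestor-injective
    where
    ancestor-injective : ∀ {i j} → ancestor dv i ≡ ancestor dv j → i ≡ j
    ancestor-injective {i} {j} eq = toℕ-injective (∸-cancelˡ-≡ (toℕ≤pred[n] i) (toℕ≤pred[n] j)
      (depth-unique (ancestor-depth dv i) (subst (λ x → Depth x (d ∸ toℕ j)) (sym eq) (ancestor-depth dv j))))

  reachesRoot⇒depth : ∀ f v → T (reachesRoot f π v) → ∃ (Depth v)
  reachesRoot⇒depth (suc f) v t with lookup π v in e
  ... | nothing = 0 , root e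
  ... | just p  = let (d , dp) = reachesRoot⇒depth f p t in suc d , step e dp

  depth⇒reachesRoot : ∀ {v d} f → Depth v d → d < f → T (reachesRoot f π v)
  depth⇒reachesRoot (suc f) (root e)    _         rewrite e = tt
  depth⇒reachesRoot (suc f) (step e dp) (s≤s d<f) rewrite e = depth⇒reachesRoot f dp d<f

  isForest⁻ : T (isForest π) → IsForest
  isForest⁻ t v = reachesRoot⇒depth n v (allV⁻ t v)

  isForest⁺ : IsForest → T (isForest π)
  isForest⁺ forest = allV⁺ λ v → let (_ , dv) = forest v in depth⇒reachesRoot n dv (depth<n dv)

  data Decreasing : Fin n → Set where
    root : ∀ {v} → lookup π v ≡ nothing → Decreasing v
    step : ∀ {v p} → lookup π v ≡ just p → toℕ v < toℕ p → Decreasing p → Decreasing v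

  decreasing-parent : ∀ {v p} → Decreasing v → lookup π v ≡ just p → toℕ v < toℕ p × Decreasing p
  decreasing-parent (root e′) e = contradiction e (root-has-no-parent e′)
  decreasing-parent (step e′ v<p dp) e with refl ← parent-unique e e′ = v<p , dp

  inMaxDec⇒decreasing : ∀ f v → T (inMaxDec f π v) → Decreasing v
  inMaxDec⇒decreasing (suc f) v t with lookup π v in e
  ... | nothing = root e
  ... | just p  = let (v<p , tp) = ∧-split t in step e (<ᵇ⇒< _ _ v<p) (inMaxDec⇒decreasing f p tp)

  decreasing⇒inMaxDec : ∀ {v d} f → Decreasing v → Depth v d → d < f → T (inMaxDec f π v)
  decreasing⇒inMaxDec (suc f) _  (root e)    _         rewrite e = tt
  decreasing⇒inMaxDec (suc f) dv (step e dp) (s≤s d<f) rewrite e =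
    let (v<p , dec-p) = decreasing-parent dv e in ∧-join (<⇒<ᵇ v<p) (decreasing⇒inMaxDec f dec-p dp d<f)

  inMaxDecSubtree⁻ : ∀ {v} → T (inMaxDecSubtree π v) → Decreasing v
  inMaxDecSubtree⁻ = inMaxDec⇒decreasing n _

  inMaxDecSubtree⁺ : IsForest → ∀ {v} → Decreasing v → T (inMaxDecSubtree π v)
  inMaxDecSubtree⁺ forest {v} dv = let (_ , d) = forest v in decreasing⇒inMaxDec n dv d (depth<n d)

rootAbove : ∀ {n} → ParentArray n → Fin n → Fin n → Bool
rootAbove π v u = isRoot π u ∧ (toℕ v <ᵇ toℕ u)

nextRoot : ∀ {n} → ParentArray n → Fin n → Maybe (Fin n)
nextRoot π v = first (rootAbove π v)

linkRoots : ∀ {n} → ParentArray n → ParentArray n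
linkRoots π = Vec.tabulate λ v → lookup π v <∣> nextRoot π v

cutMaxDec : ∀ {n} → ParentArray n → ParentArray n
cutMaxDec τ = Vec.tabulate λ v → if inMaxDecSubtree τ v then nothing else lookup τ v

module _ {n : ℕ} (π : ParentArray n) where

  nextRoot-just : ∀ {v s} → nextRoot π v ≡ just s →
    lookup π s ≡ nothing × toℕ v < toℕ s ×
    (∀ {t} → lookup π t ≡ nothing → toℕ v < toℕ t → ¬ toℕ t < toℕ s)
  nextRoot-just {v} e =
    let (above , least) = first-just (rootAbove π v) e
        (rs , v<s) = ∧-split above
    in isRoot⁻ π rs , <ᵇ⇒< _ _ v<s ,
       λ {t} rt v<t t<s → least t t<s (∧-join (isRoot⁺ π rt) (<⇒<ᵇ v<t))

  nextRoot-nothing : ∀ {v t} → nextRoot π v ≡ nothing → lookup π t ≡ nothing → ¬ toℕ v < toℕ t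
  nextRoot-nothing {v} {t} e rt v<t = first-nothing (rootAbove π v) e t (∧-join (isRoot⁺ π rt) (<⇒<ᵇ v<t))

  nextRoot-injective : ∀ {a b v} → lookup π a ≡ nothing → lookup π b ≡ nothing →
    nextRoot π a ≡ just v → nextRoot π b ≡ just v → a ≡ b
  nextRoot-injective {a} {b} ra rb na nb with nextRoot-just na | nextRoot-just nb | <-cmp (toℕ a) (toℕ b)
  ... | _ , _ , a-least | _ , b<v , _ | tri< a<b _ _ = contradiction b<v (a-least rb a<b)
  ... | _ | _ | tri≈ _ a≡b _ = toℕ-injective a≡b
  ... | _ , a<v , _ | _ , _ , b-least | tri> _ _ b<a = contradiction a<v (b-least ra b<a)

  linkRoots-child : ∀ {v p} → lookup π v ≡ just p → lookup (linkRoots π) v ≡ just p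
  linkRoots-child {v} e = trans (lookup∘tabulate _ v) (cong (_<∣> nextRoot π v) e)

  linkRoots-root : ∀ {v} → lookup π v ≡ nothing → lookup (linkRoots π) v ≡ nextRoot π v
  linkRoots-root {v} e = trans (lookup∘tabulate _ v) (cong (_<∣> nextRoot π v) e)

  linkRoots-rootOf : ∀ {a} → lookup (linkRoots π) a ≡ nothing →
    lookup π a ≡ nothing × nextRoot π a ≡ nothing
  linkRoots-rootOf {a} e with lookup π a in ea
  ... | nothing = refl , trans (sym (linkRoots-root ea)) e
  ... | just _  = contradiction (linkRoots-child ea) (root-has-no-parent (linkRoots π) e)

  linkRoots-uniqueRoot : AtMostOne (isRoot (linkRoots π))
  linkRoots-uniqueRoot {a} {b} ta tb
    with linkRoots-rootOf (isRoot⁻ (linkRoots π) ta) | linkRoots-rootOf (isRoot⁻ (linkRoots π) tb)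
       | <-cmp (toℕ a) (toℕ b)
  ... | _ , na | rb , _ | tri< a<b _ _ = contradiction a<b (nextRoot-nothing na rb)
  ... | _ | _ | tri≈ _ a≡b _ = toℕ-injective a≡b
  ... | ra , _ | _ , nb | tri> _ _ b<a = contradiction b<a (nextRoot-nothing nb ra)

module Linking {n : ℕ} (π : ParentArray n) (forest : IsForest π) (minimal : Minimal π) where

  σ : ParentArray n
  σ = linkRoots π

  root-chain : ∀ {r} → Acc _>_ r → lookup π r ≡ nothing → ∃ (Depth σ r) × Decreasing σ r
  root-chain {r} (acc above) rr with nextRoot π r in e
  ... | nothing = let σr = trans (linkRoots-root π rr) e in (0 , root σr) , root σr
  ... | just s  =
    let σr = trans (linkRoots-root π rr) e
        (rs , r<s , _) = nextRoot-just π e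
        ((d , ds) , dec-s) = root-chain (above r<s) rs
    in (suc d , step σr ds) , step σr r<s dec-s

  linked-root : ∀ {r} → lookup π r ≡ nothing → ∃ (Depth σ r) × Decreasing σ r
  linked-root = root-chain (>-wellFounded _)

  linked-depth : ∀ {v d} → Depth π v d → ∃ (Depth σ v)
  linked-depth (root e)    = proj₁ (linked-root e)
  linked-depth (step e dp) = let (d , dσ) = linked-depth dp in suc d , step (linkRoots-child π e) dσ

  linked-forest : IsForest σ
  linked-forest v = linked-depth (proj₂ (forest v))

  -- A decreasing path from a non-root must reach an original root through an
  -- original edge, and by minimality that edge increases the label.
  child-not-decreasing : ∀ {v p} → lookup π v ≡ just p → ¬ Decreasing σ v
  child-not-decreasing e (root e′) = contradiction (linkRoots-child π e) (root-has-no-parent σ e′)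
  child-not-decreasing {p = p} e (step e′ v<p dec-p) with refl ← parent-unique σ (linkRoots-child π e) e′
    with lookup π p in ep
  ... | nothing = <-asym v<p (minimal e ep)
  ... | just _  = child-not-decreasing ep dec-p

  inMaxDecSubtree-linked : ∀ v → inMaxDecSubtree σ v ≡ isRoot π v
  inMaxDecSubtree-linked v with lookup π v in e
  ... | nothing = Equivalence.to T-≡ (inMaxDecSubtree⁺ σ linked-forest (proj₂ (linked-root e)))
  ... | just _  = ¬-not λ dec → child-not-decreasing e (inMaxDecSubtree⁻ σ (Equivalence.from T-≡ dec))

  decreasingChild-linked : ∀ {u v} → T (isChildOf σ u v ∧ inMaxDecSubtree σ u) →
    lookup π u ≡ nothing × nextRoot π u ≡ just v
  decreasingChild-linked {u} t =
    let (child , dec) = ∧-split t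
        ru = isRoot⁻ π (subst T (inMaxDecSubtree-linked u) dec)
    in ru , trans (sym (linkRoots-root π ru)) (isChildOf⁻ σ child)

  linked-chain : ∀ v → AtMostOne (λ u → isChildOf σ u v ∧ inMaxDecSubtree σ u)
  linked-chain v ta tb =
    let (ra , na) = decreasingChild-linked ta
        (rb , nb) = decreasingChild-linked tb
    in nextRoot-injective π ra rb na nb

  cut-linked : cutMaxDec σ ≡ π
  cut-linked = lookup-ext λ v → trans (lookup∘tabulate _ v)
    (trans (cong (λ b → if b then nothing else lookup σ v) (inMaxDecSubtree-linked v)) (cut v))
    where
    cut : ∀ v → (if isRoot π v then nothing else lookup σ v) ≡ lookup π v
    cut v with lookup π v in e
    ... | nothing = refl
    ... | just _  = linkRoots-child π e

module _ {n : ℕ} (τ : ParentArray n) where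

  cutMaxDec-inside : ∀ {v} → inMaxDecSubtree τ v ≡ true → lookup (cutMaxDec τ) v ≡ nothing
  cutMaxDec-inside {v} m = trans (lookup∘tabulate _ v) (cong (λ b → if b then nothing else lookup τ v) m)

  cutMaxDec-outside : ∀ {v} → inMaxDecSubtree τ v ≡ false → lookup (cutMaxDec τ) v ≡ lookup τ v
  cutMaxDec-outside {v} m = trans (lookup∘tabulate _ v) (cong (λ b → if b then nothing else lookup τ v) m)

module Cutting {n : ℕ} (τ : ParentArray n) (forest : IsForest τ) where

  ρ : ParentArray n
  ρ = cutMaxDec τ

  root-inMaxDec : ∀ {v} → lookup τ v ≡ nothing → inMaxDecSubtree τ v ≡ true
  root-inMaxDec e = Equivalence.to T-≡ (inMaxDecSubtree⁺ τ forest (root e))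

  outside-not-decreasing : ∀ {v} → inMaxDecSubtree τ v ≡ false → ¬ Decreasing τ v
  outside-not-decreasing m dv = subst T m (inMaxDecSubtree⁺ τ forest dv)

  cut-depth : ∀ {v d} → Depth τ v d → ∃ (Depth ρ v)
  cut-depth (root e) = 0 , root (cutMaxDec-inside τ (root-inMaxDec e))
  cut-depth {v} (step e dp) with inMaxDecSubtree τ v in m
  ... | true  = 0 , root (cutMaxDec-inside τ m)
  ... | false = let (d , dρ) = cut-depth dp in suc d , step (trans (cutMaxDec-outside τ m) e) dρ

  cut-forest : IsForest ρ
  cut-forest v = cut-depth (proj₂ (forest v))

  isRoot-cut : ∀ v → isRoot ρ v ≡ inMaxDecSubtree τ v
  isRoot-cut v with inMaxDecSubtree τ v in m
  ... | true  = Equivalence.to T-≡ (isRoot⁺ ρ (cutMaxDec-inside τ m))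
  ... | false with lookup τ v in e
  ...   | nothing = contradiction (trans (sym (root-inMaxDec e)) m) λ ()
  ...   | just _  = cong Maybe.is-nothing (trans (cutMaxDec-outside τ m) e)

  cutRoot⇒decreasing : ∀ {r} → lookup ρ r ≡ nothing → Decreasing τ r
  cutRoot⇒decreasing {r} e = inMaxDecSubtree⁻ τ (subst T (isRoot-cut r) (isRoot⁺ ρ e))

  decreasing⇒cutRoot : ∀ {r} → Decreasing τ r → lookup ρ r ≡ nothing
  decreasing⇒cutRoot {r} dr = isRoot⁻ ρ (subst T (sym (isRoot-cut r)) (inMaxDecSubtree⁺ τ forest dr))

  -- If v < p, the edge from v to the cut root p would put v in the decreasing subtree.
  cut-minimal : Minimal ρ
  cut-minimal {v} {p} ev ep with inMaxDecSubtree τ v in m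
  ... | true  = contradiction ev (root-has-no-parent ρ (cutMaxDec-inside τ m))
  ... | false with <-cmp (toℕ v) (toℕ p)
  ...   | tri> _ _ p<v = p<v
  ...   | tri< v<p _ _ = contradiction
      (step (trans (sym (cutMaxDec-outside τ m)) ev) v<p (cutRoot⇒decreasing ep)) (outside-not-decreasing m)
  ...   | tri≈ _ v≡p _ = contradiction
      (subst (Decreasing τ) (sym (toℕ-injective v≡p)) (cutRoot⇒decreasing ep)) (outside-not-decreasing m)

  cut-numRoots : numRoots ρ ≡ maxDecSize τ
  cut-numRoots = count-cong isRoot-cut

module Relinking {n : ℕ} (τ : ParentArray n) (forest : IsForest τ)
  (uniqueRoot : AtMostOne (isRoot τ))
  (chain : ∀ v → AtMostOne (λ u → isChildOf τ u v ∧ inMaxDecSubtree τ u)) where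

  open Cutting τ forest

  decreasing-child : ∀ {u p} → lookup τ u ≡ just p → Decreasing τ u →
    T (isChildOf τ u p ∧ inMaxDecSubtree τ u)
  decreasing-child e du = ∧-join (isChildOf⁺ τ e) (inMaxDecSubtree⁺ τ forest du)

  sameDepth⇒≡ : ∀ {u w a} → Decreasing τ u → Decreasing τ w → Depth τ u a → Depth τ w a → u ≡ w
  sameDepth⇒≡ _ _ (root eu) (root ew) = uniqueRoot (isRoot⁺ τ eu) (isRoot⁺ τ ew)
  sameDepth⇒≡ du dw (step eu dpu) (step ew dpw)
    with refl ← sameDepth⇒≡ (proj₂ (decreasing-parent τ du eu)) (proj₂ (decreasing-parent τ dw ew)) dpu dpw
    = chain _ (decreasing-child eu du) (decreasing-child ew dw)

  decreasing-ancestor : ∀ {w a b} → Decreasing τ w → Depth τ w b → a < b →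
    ∃ λ x → Decreasing τ x × Depth τ x a × toℕ w < toℕ x
  decreasing-ancestor dw (step e dp) a<b with decreasing-parent τ dw e | m<1+n⇒m<n∨m≡n a<b
  ... | w<p , dec-p | inj₂ refl = _ , dec-p , dp , w<p
  ... | w<p , dec-p | inj₁ a<b′ =
    let (x , dec-x , dx , p<x) = decreasing-ancestor dec-p dp a<b′ in x , dec-x , dx , <-trans w<p p<x

  deeper⇒smaller : ∀ {u w a b} → Decreasing τ u → Depth τ u a → Decreasing τ w → Depth τ w b →
    a < b → toℕ w < toℕ u
  deeper⇒smaller du da dw db a<b with decreasing-ancestor dw db a<b
  ... | x , dec-x , dx , w<x with refl ← sameDepth⇒≡ dec-x du dx da = w<x

  smaller⇒deeper : ∀ {u w a b} → Decreasing τ u → Depth τ u a → Decreasing τ w → Depth τ w b →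
    toℕ w < toℕ u → a < b
  smaller⇒deeper {a = a} {b} du da dw db w<u with <-cmp a b
  ... | tri< a<b _ _ = a<b
  ... | tri≈ _ refl _ with refl ← sameDepth⇒≡ du dw da db = contradiction w<u (<-irrefl refl)
  ... | tri> _ _ b<a = contradiction w<u (<-asym (deeper⇒smaller dw db du da b<a))

  -- The roots of the cut forest are the chain, ordered by depth and inversely by label,
  -- so the next root above v is its parent in τ.
  nextRoot-cut : ∀ {v} → Decreasing τ v → nextRoot ρ v ≡ lookup τ v
  nextRoot-cut {v} dv with lookup τ v in ev | nextRoot ρ v in en
  ... | nothing | nothing = refl
  ... | nothing | just s =
    let (rs , v<s , _) = nextRoot-just ρ en
        (_ , ds) = forest s
    in contradiction (smaller⇒deeper (cutRoot⇒decreasing rs) ds dv (root ev) v<s) λ ()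
  ... | just p | nothing =
    let (v<p , dec-p) = decreasing-parent τ dv ev
    in contradiction v<p (nextRoot-nothing ρ en (decreasing⇒cutRoot dec-p))
  ... | just p | just s with nextRoot-just ρ en | decreasing-parent τ dv ev | forest p | forest s
  ...   | rs , v<s , least | v<p , dec-p | _ , dp | _ , ds with <-cmp (toℕ s) (toℕ p)
  ...     | tri≈ _ s≡p _ = cong just (toℕ-injective s≡p)
  ...     | tri> _ _ p<s = contradiction p<s (least (decreasing⇒cutRoot dec-p) v<p)
  ...     | tri< s<p _ _ =
    let dec-s = cutRoot⇒decreasing rs
    in contradiction (s≤s⁻¹ (smaller⇒deeper dec-s ds dv (step ev dp) v<s))
                     (<⇒≱ (smaller⇒deeper dec-p dp dec-s ds s<p))

  relink-cut : linkRoots ρ ≡ τ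
  relink-cut = lookup-ext λ v → trans (lookup∘tabulate _ v) (relinked v)
    where
    relinked : ∀ v → (lookup ρ v <∣> nextRoot ρ v) ≡ lookup τ v
    relinked v with inMaxDecSubtree τ v in m
    ... | true  = trans (cong (_<∣> nextRoot ρ v) (cutMaxDec-inside τ m))
                        (nextRoot-cut (inMaxDecSubtree⁻ τ (Equivalence.from T-≡ m)))
    ... | false with lookup τ v in e
    ...   | nothing = contradiction (trans (sym (root-inMaxDec e)) m) λ ()
    ...   | just _  = cong (_<∣> nextRoot ρ v) (trans (cutMaxDec-outside τ m) e)

record IsMinimalForest {n : ℕ} (π : ParentArray n) (k : ℕ) : Set where
  field
    forest    : IsForest π
    numRoots≡ : numRoots π ≡ k
    minimal   : Minimal π

record IsChainTree {n : ℕ} (τ : ParentArray n) (k : ℕ) : Set where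
  field
    forest    : IsForest τ
    oneRoot   : numRoots τ ≡ 1
    chain     : ∀ v → AtMostOne (λ u → isChildOf τ u v ∧ inMaxDecSubtree τ u)
    size      : maxDecSize τ ≡ k

isMinimalForest⇔ : ∀ {n k} (π : ParentArray n) →
  T (isForest π ∧ (numRoots π ≡ᵇ k) ∧ allTreesMinimal π) ⇔ IsMinimalForest π k
isMinimalForest⇔ π = mk⇔
  (λ t → let (f , r , m) = ∧-split₃ t in record
    { forest = isForest⁻ π f ; numRoots≡ = ≡ᵇ⇒≡ _ _ r ; minimal = allTreesMinimal⁻ π m })
  (λ mf → let open IsMinimalForest mf in
    ∧-join (isForest⁺ π forest) (∧-join (≡⇒≡ᵇ _ _ numRoots≡) (allTreesMinimal⁺ π minimal)))

isChainTree⇔ : ∀ {n k} (τ : ParentArray n) →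
  T (isTree τ ∧ maxDecIsChain τ ∧ (maxDecSize τ ≡ᵇ k)) ⇔ IsChainTree τ k
isChainTree⇔ τ = mk⇔
  (λ t → let (tree , ch , sz) = ∧-split₃ t ; (f , r) = ∧-split tree in record
    { forest = isForest⁻ τ f ; oneRoot = ≡ᵇ⇒≡ _ _ r
    ; chain = λ v → count≤1⇒atMostOne (≤ᵇ⇒≤ _ _ (allV⁻ ch v)) ; size = ≡ᵇ⇒≡ _ _ sz })
  (λ ct → let open IsChainTree ct in
    ∧-join (∧-join (isForest⁺ τ forest) (≡⇒≡ᵇ _ _ oneRoot))
           (∧-join (allV⁺ λ v → ≤⇒≤ᵇ (atMostOne⇒count≤1 (chain v))) (≡⇒≡ᵇ _ _ size)))

linkRoots-isChainTree : ∀ {n k} {π : ParentArray n} → Fin n → IsMinimalForest π k →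
  IsChainTree (linkRoots π) k
linkRoots-isChainTree {π = π} v₀ mf = record
  { forest  = linked-forest
  ; oneRoot = let (_ , er) = depth⇒root σ (proj₂ (linked-forest v₀))
              in count≡1 {P = isRoot σ} (isRoot⁺ σ er) (linkRoots-uniqueRoot π)
  ; chain   = linked-chain
  ; size    = trans (count-cong inMaxDecSubtree-linked) numRoots≡
  }
  where
  open IsMinimalForest mf
  open Linking π forest minimal

cutMaxDec-isMinimalForest : ∀ {n k} {τ : ParentArray n} → IsChainTree τ k →
  IsMinimalForest (cutMaxDec τ) k
cutMaxDec-isMinimalForest {τ = τ} ct = record
  { forest = cut-forest ; numRoots≡ = trans cut-numRoots size ; minimal = cut-minimal }
  where
  open IsChainTree ct
  open Cutting τ forest

cutMaxDec∘linkRoots : ∀ {n k} {π : ParentArray n} → IsMinimalForest π k → cutMaxDec (linkRoots π) ≡ π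
cutMaxDec∘linkRoots {π = π} mf = Linking.cut-linked π forest minimal
  where open IsMinimalForest mf

linkRoots∘cutMaxDec : ∀ {n k} {τ : ParentArray n} → IsChainTree τ k → linkRoots (cutMaxDec τ) ≡ τ
linkRoots∘cutMaxDec {τ = τ} ct =
  Relinking.relink-cut τ forest (count≤1⇒atMostOne (≤-reflexive oneRoot)) chain
  where open IsChainTree ct

mainTheorem19 : (n k : ℕ) → 1 ≤ n → 1 ≤ k → M n k ↔ T′ n k
mainTheorem19 n k 1≤n _ = mk↔ₛ′ link cut link∘cut cut∘link
  where
  link : M n k → T′ n k
  link (π , t) = linkRoots π ,
    Equivalence.from (isChainTree⇔ _) (linkRoots-isChainTree (fromℕ< 1≤n) (Equivalence.to (isMinimalForest⇔ π) t))

  cut : T′ n k → M n k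
  cut (τ , t) = cutMaxDec τ ,
    Equivalence.from (isMinimalForest⇔ _) (cutMaxDec-isMinimalForest (Equivalence.to (isChainTree⇔ τ) t))

  link∘cut : ∀ y → link (cut y) ≡ y
  link∘cut (τ , t) = T-subtype-≡ (linkRoots∘cutMaxDec (Equivalence.to (isChainTree⇔ τ) t))

  cut∘link : ∀ x → cut (link x) ≡ x
  cut∘link (π , t) = T-subtype-≡ (cutMaxDec∘linkRoots (Equivalence.to (isMinimalForest⇔ π) t))
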